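{- Let $G$ be any simple, undirected, connected graph on $n$ vertices. In the cat and mouse game on $G$, there is a cat strategy such that, whatever moves the mouse makes, some time step $i\le\sqrt{2n}$ satisfies $\mathrm{rad}_G(M_i)\le\sqrt{32n}$. That is, the cat can localise the mouse up to distance $\sqrt{32n}$ by time $\sqrt{2n}$.
   Context: The cat and mouse game on a connected graph $G$ of order $n$ is played in discrete time steps $i=1,2,\dots$. The mouse occupies vertices $m_1,m_2,\dots$, where for $i\ge 2$ the vertex $m_i$ lies in the closed neighbourhood of $m_{i-1}$. The cat tests vertices $c_1,c_2,\dots$ of $G$ with no restriction. At the end of each step $i\ge 2$ the cat is told $b_i=1$ if $d(c_i,m_i)\le d(c_{i-1},m_{i-1})$ and $b_i=0$ otherwise, where $d$ is the graph distance. A strategy of the cat is deterministic and fixed in advance: $c_1,c_2$ are fixed vertices and $c_i=f(b_2,\dots,b_{i-1})$ for $i\ge 3$, for some function $f$ from finite $0/1$ strings to $V(G)$. The mouse knows the cat's strategy. $M_i$ is the set of vertices $v$ for which there exist $\tilde m_1,\dots,\tilde m_i$ such that: - $\tilde m_i=v$; - $\tilde m_j$ lies in the closed neighbourhood of $\tilde m_{j-1}$ for $2\le j\le i$; - for each $2\le j\le i$, $d(c_j,\tilde m_j)\le d(c_{j-1},\tilde m_{j-1})$ holds if and only if $b_j=1$. The radius of a vertex set $W$ is $\mathrm{rad}_G(W)=\min_{v\in V(G)}\max_{w\in W} d(v,w)$. "The cat can localise the mouse up to distance $d$ by (within) time $t$" means: there is a cat strategy such that, for every mouse sequence, some $i\le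 t$ has $\mathrm{rad}_G(M_i)\le d$. -}

module Defs where

open import Data.Nat using (ℕ; zero; suc; _≤_; _≤ᵇ_)
open import Data.Bool using (Bool; true; false; _∧_; _∨_; if_then_else_)
open import Data.Fin using (Fin; _≟_)
open import Data.List using (List; []; _∷_; _++_; allFin)
open import Data.Bool.ListAction using (any)
open import Data.Product using (Σ; ∃; _×_; _,_)
open import Data.Sum using (_⊎_)
open import Relation.Binary.PropositionalEquality using (_≡_)
open import Relation.Nullary.Decidable using (⌊_⌋)
open import Function.Bundles using (_⇔_)

record Graph (n : ℕ) : Set where
  field
    adj    : Fin n → Fin n → Bool
    sym    : ∀ u v → adj u v ≡ adj v u
    irrefl : ∀ u → adj u u ≡ false
open Graph public

module _ {n : ℕ} (G : Graph n) where

  data Walk : Fin n → Fin n → ℕ → Set where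
    here : ∀ {u} → Walk u u 0
    step : ∀ {u w v k} → adj G u w ≡ true → Walk w v k → Walk u v (suc k)

  Connected : Set
  Connected = ∀ u v → ∃ λ k → Walk u v k

  reach : ℕ → Fin n → Fin n → Bool
  reach zero    u v = ⌊ u ≟ v ⌋
  reach (suc k) u v = reach k u v ∨ any (λ w → reach k u w ∧ adj G w v) (allFin n)

  search : ℕ → ℕ → Fin n → Fin n → ℕ
  search zero     k u v = k
  search (suc fu) k u v = if reach k u v then k else search fu (suc k) u v

  -- graph distance d(u,v) (correct for connected graphs, where d(u,v) < n)
  dist : Fin n → Fin n → ℕ
  dist u v = search n 0 u v

  InClosedNbhd : Fin n → Fin n → Set
  InClosedNbhd u v = v ≡ u ⊎ adj G u v ≡ true

  -- a mouse sequence m_1, m_2, ... (index 0 is unused)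
  ValidMouse : (ℕ → Fin n) → Set
  ValidMouse m = ∀ i → 1 ≤ i → InClosedNbhd (m i) (m (suc i))

-- A deterministic cat strategy: fixed c₁, c₂ and c_i = f(b₂,…,b_{i-1}) for i ≥ 3.
record Strategy (n : ℕ) : Set where
  field
    c₁ : Fin n
    c₂ : Fin n
    f  : List Bool → Fin n
open Strategy public

module Play {n : ℕ} (G : Graph n) (S : Strategy n) (m : ℕ → Fin n) where

  catGiven : ℕ → List Bool → Fin n
  catGiven zero                bs = c₁ S
  catGiven (suc zero)          bs = c₁ S
  catGiven (suc (suc zero))    bs = c₂ S
  catGiven (suc (suc (suc i))) bs = f S bs

  -- bits i = [b₂, …, b_i]  (empty for i ≤ 1)
  bits : ℕ → List Bool
  bits zero          = []
  bits (suc zero)    = []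
  bits (suc (suc i)) =
    bits (suc i) ++
      ((dist G (catGiven (suc (suc i)) (bits (suc i))) (m (suc (suc i)))
          ≤ᵇ dist G (catGiven (suc i) (bits i)) (m (suc i))) ∷ [])

  -- cat's tested vertex c_i (i ≥ 1; index 0 is unused)
  cat : ℕ → Fin n
  cat i = catGiven i (bits (Data.Nat.pred i))

  -- bit i = b_{i+1} = 1 iff d(c_{i+1}, m_{i+1}) ≤ d(c_i, m_i)
  bit : ℕ → Bool
  bit i = dist G (cat (suc i)) (m (suc i)) ≤ᵇ dist G (cat i) (m i)

  InM : ℕ → Fin n → Set
  InM i v = Σ (ℕ → Fin n) λ m̃ →
      (m̃ i ≡ v)
    × (∀ j → 2 ≤ j → j ≤ i → InClosedNbhd G (m̃ (Data.Nat.pred j)) (m̃ j))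
    × (∀ j → 1 ≤ j → suc j ≤ i →
         (dist G (cat (suc j)) (m̃ (suc j)) ≤ dist G (cat j) (m̃ j)) ⇔ (bit j ≡ true))

RadLe : ∀ {n} → Graph n → (Fin n → Set) → ℕ → Set
RadLe {n} G W r = Σ (Fin n) λ c → ∀ w → W w → dist G c w ≤ r

-- Choose k with (2k+1)² ≤ 2n < (2k+3)² and put Q = 2k + 4.  Sorting the vertices
-- by their distance from a fixed vertex o modulo Q + 1, the pigeonhole principle
-- (n < (Q + 1)(k + 1)) gives a residue class, a union of BFS layers, with L ≤ k
-- vertices; together with o it Q-dominates G, by walking along shortest paths.
-- The cat plays a tournament over o and this layer: round p (times 2p+1, 2p+2)
-- tests the current leader, then the next challenger, which takes the lead iff its
-- distance did not increase.  Since the mouse moves with speed one, after p rounds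
-- the leader is within 4p of everyone who has played, for every mouse trajectory
-- consistent with the answers.  So at time 2L + 1 ≤ 2k + 1 every possible mouse
-- position is within Q + 4L ≤ 4(2k + 1) ≤ √(32n) of the leader.
module Submission where

open import Defs hiding (sym)
open import Data.Nat using (ℕ; _≤_; _*_)
open import Data.Fin using (Fin)
open import Data.Product using (Σ; _×_)

open import Data.Nat using (zero; suc; _+_; _∸_; _<_; _≟_; _<?_; _≤?_; z≤n; s≤s; s≤s⁻¹; pred)
open import Data.Nat.DivMod using (_%_; _/_; m≡m%n+[m/n]*n; m%n<n; [m+kn]%n≡m%n; m<n⇒m%n≡m)
open import Data.Nat.Properties
open import Data.Nat.Induction using (<-rec)
open import Data.Nat.Tactic.RingSolver using (solve-∀)
open import Data.Bool using (Bool; true; false; _∧_; _∨_; T; if_then_else_)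
open import Data.Bool.Properties using (∨-zeroʳ; T-≡)
open import Data.Bool.ListAction using (any)
open import Data.Fin using (toℕ; fromℕ<) renaming (_≟_ to _≟ᶠ_)
open import Data.Fin.Properties using (pigeonhole; toℕ<n)
open import Data.List using (List; []; _∷_; _++_; [_]; length; filter; drop; allFin)
open import Data.List.Properties using (drop-drop; drop-all; length-tabulate)
open import Data.List.Membership.Propositional using (_∈_)
open import Data.List.Membership.Propositional.Properties using (∈-allFin; ∈-filter⁺)
open import Data.List.Relation.Unary.Any using (satisfied)
import Data.List.Relation.Unary.Any as Any
open import Data.List.Relation.Unary.Any.Properties using (any⁺; any⁻)
open import Data.Product using (∃; ∃₂; _,_; proj₁; proj₂)
open import Data.Sum using (_⊎_; inj₁; inj₂)
open import Data.Empty using (⊥-elim)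
open import Function.Bundles using (Equivalence; _⇔_)
open import Relation.Nullary using (¬_; yes; no; contradiction)
open import Relation.Unary using (Decidable)
open import Relation.Unary.Properties using (∁?)
open import Relation.Nullary.Decidable using (dec-true; isYes≗does)
open import Relation.Binary.PropositionalEquality
  using (_≡_; refl; cong; subst; subst₂; sym; trans; module ≡-Reasoning)

-- The odd numbers round p = 2p + 1; round p of the tournament starts at this time.
twice : ℕ → ℕ
twice zero    = zero
twice (suc p) = suc (suc (twice p))

round : ℕ → ℕ
round p = suc (twice p)

twice-closed : ∀ p → twice p ≡ p + p
twice-closed zero    = refl
twice-closed (suc p) = cong suc (trans (cong suc (twice-closed p)) (sym (+-suc p p)))

round-mono : ∀ {L k} → L ≤ k → round L ≤ round k
round-mono {L} {k} L≤k =
  s≤s (subst₂ _≤_ (sym (twice-closed L)) (sym (twice-closed k)) (+-mono-≤ L≤k L≤k))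

round-< : ∀ k → round k < round (suc k)
round-< k = m≤n⇒m≤1+n (n<1+n (round k))

square-mono : ∀ {a b} → a ≤ b → a * a ≤ b * b
square-mono a≤b = *-mono-≤ a≤b a≤b

odd-square-bracket : ∀ N → 1 ≤ N →
                     ∃ λ k → round k * round k ≤ N × N < round (suc k) * round (suc k)
odd-square-bracket (suc zero) _ = 0 , ≤-refl , s≤s (s≤s z≤n)
odd-square-bracket (suc (suc N)) _ with k , lower , upper ← odd-square-bracket (suc N) (s≤s z≤n)
  with suc (suc N) <? round (suc k) * round (suc k)
... | yes below = k , ≤-trans lower (n≤1+n _) , below
... | no  above = suc k , ≮⇒≥ above ,
  ≤-<-trans upper (*-mono-< (round-< (suc k)) (round-< (suc k)))

-- If 2n < (2k+3)² then n < (2k+5)(k+1): the n vertices fit into fewer than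
-- 2k + 5 classes of k + 1.
layer-count : ∀ n k → 2 * n < round (suc k) * round (suc k) → n < suc (4 + (k + k)) * suc k
layer-count n k upper = *-cancelˡ-< 2 n (suc (4 + (k + k)) * suc k) (begin-strict
  2 * n                                             <⟨ upper ⟩
  round (suc k) * round (suc k)                     ≡⟨ cong (λ t → suc t * suc t) (twice-closed (suc k)) ⟩
  suc (suc k + suc k) * suc (suc k + suc k)         ≤⟨ m≤m+n _ (suc (k + k)) ⟩
  suc (suc k + suc k) * suc (suc k + suc k) + suc (k + k) ≡⟨ expand k ⟩
  2 * (suc (4 + (k + k)) * suc k)                   ∎)
  where
    open ≤-Reasoning
    expand : ∀ k → suc (suc k + suc k) * suc (suc k + suc k) + suc (k + k) ≡
                   2 * (suc (4 + (k + k)) * suc k)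
    expand = solve-∀

-- The radius Q + 4L with Q = 2k + 4 and L ≤ k is at most 4(2k+1), whose square is at most 32n.
radius-bound : ∀ {n k L} → L ≤ k → round k * round k ≤ 2 * n →
               (4 + (k + k) + 4 * L) * (4 + (k + k) + 4 * L) ≤ 32 * n
radius-bound {n} {k} {L} L≤k lower = begin
  r * r                                   ≤⟨ square-mono r≤ ⟩
  (4 * round k) * (4 * round k)           ≡⟨ reorder (round k) ⟩
  16 * (round k * round k)                ≤⟨ *-monoʳ-≤ 16 lower ⟩
  16 * (2 * n)                            ≡⟨ *-assoc 16 2 n ⟨
  32 * n                                  ∎
  where
    open ≤-Reasoning
    r : ℕ
    r = 4 + (k + k) + 4 * L
    reorder : ∀ a → (4 * a) * (4 * a) ≡ 16 * (a * a)
    reorder = solve-∀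
    spread : ∀ k → 4 * suc (k + k) ≡ 4 + (k + k) + 4 * k + (k + k)
    spread = solve-∀
    r≤ : r ≤ 4 * round k
    r≤ = begin
      4 + (k + k) + 4 * L               ≤⟨ +-monoʳ-≤ (4 + (k + k)) (*-monoʳ-≤ 4 L≤k) ⟩
      4 + (k + k) + 4 * k               ≤⟨ m≤m+n _ (k + k) ⟩
      4 + (k + k) + 4 * k + (k + k)     ≡⟨ sym (spread k) ⟩
      4 * suc (k + k)                   ≡⟨ cong (λ t → 4 * suc t) (sym (twice-closed k)) ⟩
      4 * round k                       ∎

time-bound : ∀ {N k L} → L ≤ k → round k * round k ≤ N → round L * round L ≤ N
time-bound L≤k lower = ≤-trans (square-mono (round-mono L≤k)) lower

residue-split : ∀ Q ρ h → ρ < suc Q → ρ ≤ h →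
                ∃₂ λ j r → h ≡ j + r × r ≤ Q × j % suc Q ≡ ρ
residue-split Q ρ h ρ<q ρ≤h =
  ρ + D * suc Q , r , h≡ , s≤s⁻¹ (m%n<n (h ∸ ρ) (suc Q)) ,
  trans ([m+kn]%n≡m%n ρ D (suc Q)) (m<n⇒m%n≡m ρ<q)
  where
    r D : ℕ
    r = (h ∸ ρ) % suc Q
    D = (h ∸ ρ) / suc Q
    h≡ : h ≡ ρ + D * suc Q + r
    h≡ = begin
      h                       ≡⟨ sym (m+[n∸m]≡n ρ≤h) ⟩
      ρ + (h ∸ ρ)             ≡⟨ cong (ρ +_) (m≡m%n+[m/n]*n (h ∸ ρ) (suc Q)) ⟩
      ρ + (r + D * suc Q)     ≡⟨ cong (ρ +_) (+-comm r (D * suc Q)) ⟩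
      ρ + (D * suc Q + r)     ≡⟨ sym (+-assoc ρ (D * suc Q) r) ⟩
      ρ + D * suc Q + r       ∎
      where open ≡-Reasoning

filter-length-split : ∀ {A : Set} {P : A → Set} (P? : Decidable P) (xs : List A) →
                      length (filter P? xs) + length (filter (∁? P?) xs) ≡ length xs
filter-length-split P? [] = refl
filter-length-split P? (x ∷ xs) with P? x
... | yes _ = cong suc (filter-length-split P? xs)
... | no  _ = trans (+-suc _ _) (cong suc (filter-length-split P? xs))

filter-absorb : ∀ {A : Set} {P Q : A → Set} (P? : Decidable P) (Q? : Decidable Q) →
                (∀ {x} → P x → Q x) → (xs : List A) → filter P? (filter Q? xs) ≡ filter P? xs
filter-absorb P? Q? P⇒Q [] = refl
filter-absorb P? Q? P⇒Q (x ∷ xs) with Q? x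
... | yes _ with P? x
...   | yes _  = cong (x ∷_) (filter-absorb P? Q? P⇒Q xs)
...   | no  _  = filter-absorb P? Q? P⇒Q xs
filter-absorb P? Q? P⇒Q (x ∷ xs) | no ¬q with P? x
...   | yes px = ⊥-elim (¬q (P⇒Q px))
...   | no  _  = filter-absorb P? Q? P⇒Q xs

key-class : ∀ {A : Set} → (A → ℕ) → ℕ → List A → List A
key-class key ρ = filter (λ x → key x ≟ ρ)

-- Pigeonhole: if fewer than q · K items are sorted by a key, some key value
-- ρ < q is taken by fewer than K of them.  (Peel off the class of q - 1.)
small-class : ∀ {A : Set} (key : A → ℕ) K q (xs : List A) → length xs < q * K →
              ∃ λ ρ → ρ < q × length (key-class key ρ xs) < K
small-class key K zero xs ()
small-class key K (suc q) xs xs<qK with length (key-class key q xs) <? K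
... | yes few  = q , ≤-refl , few
... | no  many = widen (small-class key K q rest rest<qK)
  where
    rest : List _
    rest = filter (∁? (λ x → key x ≟ q)) xs
    rest<qK : length rest < q * K
    rest<qK = +-cancelˡ-< K (length rest) (q * K)
      (≤-<-trans (≤-trans (+-monoˡ-≤ (length rest) (≮⇒≥ many))
                          (≤-reflexive (filter-length-split _ xs))) xs<qK)
    -- below q, the classes of `rest` are those of `xs`
    widen : (∃ λ ρ → ρ < q × length (key-class key ρ rest) < K) →
            ∃ λ ρ → ρ < suc q × length (key-class key ρ xs) < K
    widen (ρ , ρ<q , few) =
      ρ , m≤n⇒m≤1+n ρ<q , subst (λ l → length l < K) (filter-absorb _ _ not-q xs) few
      where
        not-q : ∀ {x} → key x ≡ ρ → ¬ (key x ≡ q)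
        not-q eq eq′ = <-irrefl (trans (sym eq) eq′) ρ<q

-- The cat keeps standings (leader, waiting
-- challengers).  Round p occupies times 2p + 1 and 2p + 2: the leader is
-- tested, then the first waiting challenger; if the challenger's distance
-- is not larger (answer 1) it becomes the leader.  Either way it stops waiting.
Standings : ℕ → Set
Standings n = Fin n × List (Fin n)

challenger : ∀ {n} → Standings n → Fin n
challenger (c , [])    = c
challenger (c , x ∷ _) = x

advance : ∀ {n} → Bool → Standings n → Standings n
advance b (c , [])     = c , []
advance b (c , x ∷ xs) = (if b then x else c) , xs

tour : ∀ {n} → Standings n → List Bool → Fin n
tour st []           = challenger st
tour st (b ∷ [])     = proj₁ (advance b st)
tour st (b ∷ _ ∷ bs) = tour (advance b st) bs

tournament : ∀ {n} → Fin n → List (Fin n) → Strategy n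
tournament s₀ cands = record { c₁ = s₀ ; c₂ = tour (s₀ , cands) [] ; f = tour (s₀ , cands) }

module Walks {n : ℕ} (G : Graph n) where

  _++ʷ_ : ∀ {u v w a b} → Walk G u v a → Walk G v w b → Walk G u w (a + b)
  here       ++ʷ q = q
  step e p   ++ʷ q = step e (p ++ʷ q)

  snoc : ∀ {u w v j} → Walk G u w j → adj G w v ≡ true → Walk G u v (suc j)
  snoc here       e = step e here
  snoc (step f p) e = step f (snoc p e)

  unsnoc : ∀ {u v j} → Walk G u v (suc j) →
           ∃ λ w → Walk G u w j × adj G w v ≡ true
  unsnoc (step e here) = _ , here , e
  unsnoc (step e (step f p)) with unsnoc (step f p)
  ... | w , q , e′ = w , step e q , e′

  -- The vertex reached after i steps (the end vertex once i exceeds the length).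
  at : ∀ {u v j} → Walk G u v j → ℕ → Fin n
  at {u} here       i       = u
  at {u} (step e p) zero    = u
  at     (step e p) (suc i) = at p i

  prefix : ∀ {u v j} (p : Walk G u v j) i → i ≤ j → Walk G u (at p i) i
  prefix here       zero    _       = here
  prefix (step e p) zero    _       = here
  prefix (step e p) (suc i) (s≤s h) = step e (prefix p i h)

  suffix : ∀ {u v j} (p : Walk G u v j) i → i ≤ j → Walk G (at p i) v (j ∸ i)
  suffix here       zero    _       = here
  suffix (step e p) zero    _       = step e p
  suffix (step e p) (suc i) (s≤s h) = suffix p i h

  -- A walk with at least n steps visits some vertex twice (pigeonhole on its
  -- first n + 1 vertices); cutting out the closed sub-walk shortens it.
  shortcut : ∀ {u v j} → n ≤ j → Walk G u v j → ∃ λ j′ → j′ < j × Walk G u v j′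
  shortcut {u} {v} {j} n≤j p
    with a , b , a<b , same ← pigeonhole (s≤s n≤j) (λ i → at p (toℕ i)) =
    toℕ a + (j ∸ toℕ b) , shorter ,
    prefix p (toℕ a) a≤j ++ʷ
      subst (λ x → Walk G x v (j ∸ toℕ b)) (sym same) (suffix p (toℕ b) b≤j)
    where
      b≤j : toℕ b ≤ j
      b≤j = s≤s⁻¹ (toℕ<n b)
      a≤j : toℕ a ≤ j
      a≤j = ≤-trans (<⇒≤ a<b) b≤j
      shorter : toℕ a + (j ∸ toℕ b) < j
      shorter = ≤-trans (+-monoˡ-< (j ∸ toℕ b) a<b) (≤-reflexive (m+[n∸m]≡n b≤j))

  shorten : ∀ {u v j} → Walk G u v j → ∃ λ j′ → j′ < n × Walk G u v j′
  shorten {u} {v} {j} = <-rec (λ j → Walk G u v j → ∃ λ j′ → j′ < n × Walk G u v j′) go j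
    where
      go : ∀ j → (∀ {i} → i < j → Walk G u v i → ∃ λ j′ → j′ < n × Walk G u v j′) →
           Walk G u v j → ∃ λ j′ → j′ < n × Walk G u v j′
      go j rec p with j <? n
      ... | yes j<n = j , j<n , p
      ... | no  j≮n with shortcut (≮⇒≥ j≮n) p
      ...   | i , i<j , q = rec i<j q

module Distance {n : ℕ} (G : Graph n) where
  open Walks G

  true-∧ : ∀ {a b} → a ≡ true → b ≡ true → T (a ∧ b)
  true-∧ refl refl = _

  ∧-true : ∀ {a b} → T (a ∧ b) → a ≡ true × b ≡ true
  ∧-true {true} {true} _ = refl , refl

  reach-walk : ∀ {u v j} → Walk G u v j → reach G j u v ≡ true
  reach-walk {u} here = trans (isYes≗does (u ≟ᶠ u)) (dec-true (u ≟ᶠ u) refl)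
  reach-walk {u} {v} {suc j} p with w , q , e ← unsnoc p =
    trans (cong (reach G j u v ∨_) last-edge) (∨-zeroʳ _)
    where
      last-edge : any (λ x → reach G j u x ∧ adj G x v) (allFin n) ≡ true
      last-edge = Equivalence.to T-≡
        (any⁺ _ (Any.map (λ { refl → true-∧ (reach-walk q) e }) (∈-allFin w)))

  walk-of-reach : ∀ k u v → reach G k u v ≡ true → ∃ λ j → j ≤ k × Walk G u v j
  walk-of-reach zero u v eq with u ≟ᶠ v
  walk-of-reach zero u v eq | yes refl = 0 , z≤n , here
  walk-of-reach zero u v () | no _
  walk-of-reach (suc k) u v eq with reach G k u v in r
  ... | true with j , j≤k , p ← walk-of-reach k u v r = j , m≤n⇒m≤1+n j≤k , p
  walk-of-reach (suc k) u v eq | false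
    with w , t ← satisfied (any⁻ _ (allFin n) (Equivalence.from T-≡ eq))
    with r₁ , e ← ∧-true t
    with j , j≤k , p ← walk-of-reach k u w r₁ = suc j , s≤s j≤k , snoc p e

  search-bound : ∀ fuel k u v → search G fuel k u v ≤ k + fuel
  search-bound zero       k u v = ≤-reflexive (sym (+-identityʳ k))
  search-bound (suc fuel) k u v with reach G k u v
  ... | true  = m≤m+n k (suc fuel)
  ... | false = ≤-trans (search-bound fuel (suc k) u v) (≤-reflexive (sym (+-suc k fuel)))

  search-finds : ∀ fuel k {u v x} → reach G x u v ≡ true → k ≤ x → x < k + fuel →
                 search G fuel k u v ≤ x × reach G (search G fuel k u v) u v ≡ true
  search-finds zero k {x = x} r k≤x x<k =
    ⊥-elim (<⇒≱ (≤-trans x<k (≤-reflexive (+-identityʳ k))) k≤x)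
  search-finds (suc fuel) k {u} {v} r k≤x x<k with reach G k u v in rk
  ... | true  = k≤x , rk
  ... | false =
    search-finds fuel (suc k) r (≤∧≢⇒< k≤x k≢x) (≤-trans x<k (≤-reflexive (+-suc k fuel)))
    where
      k≢x : ¬ (k ≡ _)
      k≢x refl with () ← trans (sym r) rk

  dist-le : ∀ {u v j} → Walk G u v j → dist G u v ≤ j
  dist-le {u} {v} {j} p with j <? n
  ... | yes j<n = proj₁ (search-finds n 0 (reach-walk p) z≤n j<n)
  ... | no  j≮n = ≤-trans (search-bound n 0 u v) (≮⇒≥ j≮n)

  Dominates : List (Fin n) → ℕ → Set
  Dominates ss Q = ∀ v → ∃ λ s → s ∈ ss × dist G s v ≤ Q

  layer : Fin n → ℕ → ℕ → List (Fin n)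
  layer o Q ρ = key-class (λ x → dist G o x % suc Q) ρ (allFin n)

  sparse-layer : ∀ o Q K → n < suc Q * K →
                 ∃ λ ρ → ρ < suc Q × length (layer o Q ρ) < K
  sparse-layer o Q K n<qK =
    small-class (λ x → dist G o x % suc Q) K (suc Q) (allFin n)
                (subst (_< suc Q * K) (sym (length-tabulate (λ i → i))) n<qK)

  module Metric (conn : Connected G) where

    -- Opaque: the geodesic is only ever used through its type; unfolding its
    -- construction (walk shortening, table search) would make type checking of
    -- `with`-abstractions over its consequences explode.
    opaque
      geodesic : ∀ u v → Walk G u v (dist G u v)
      geodesic u v
        with j , j<n , p ← shorten (proj₂ (conn u v))
        with j′ , j′≤d , q ← walk-of-reach _ u v (proj₂ (search-finds n 0 (reach-walk p) z≤n j<n))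
        = subst (Walk G u v) (≤-antisym j′≤d (dist-le q)) q

    triangle : ∀ u v w → dist G u w ≤ dist G u v + dist G v w
    triangle u v w = dist-le (geodesic u v ++ʷ geodesic v w)

    nbhd-dist : ∀ {u v} → InClosedNbhd G u v → dist G u v ≤ 1 × dist G v u ≤ 1
    nbhd-dist {u} (inj₁ refl) = stay , stay
      where
        stay : dist G u u ≤ 1
        stay = ≤-trans (dist-le (here {u = u})) z≤n
    nbhd-dist {u} {v} (inj₂ e) =
      dist-le (step e here) , dist-le (step (trans (Graph.sym G v u) e) here)

    move-away : ∀ c {u v} → InClosedNbhd G u v → dist G c v ≤ suc (dist G c u)
    move-away c {u} {v} uv = ≤-trans (triangle c u v)
      (≤-trans (+-monoʳ-≤ (dist G c u) (proj₁ (nbhd-dist uv))) (≤-reflexive (+-comm _ 1)))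

    move-back : ∀ c {u v} → InClosedNbhd G u v → dist G c u ≤ suc (dist G c v)
    move-back c {u} {v} uv = ≤-trans (triangle c v u)
      (≤-trans (+-monoʳ-≤ (dist G c v) (proj₂ (nbhd-dist uv))) (≤-reflexive (+-comm _ 1)))

    geodesic-split : ∀ o v j r → dist G o v ≡ j + r →
                     ∃ λ u → dist G o u ≡ j × dist G u v ≤ r
    geodesic-split o v j r h≡ = u , ≤-antisym (dist-le to-u) j≤dou , duv≤r
      where
        p : Walk G o v (j + r)
        p = subst (Walk G o v) h≡ (geodesic o v)
        u : Fin n
        u = at p j
        to-u : Walk G o u j
        to-u = prefix p j (m≤m+n j r)
        duv≤r : dist G u v ≤ r
        duv≤r = ≤-trans (dist-le (suffix p j (m≤m+n j r))) (≤-reflexive (m+n∸m≡n j r))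
        j≤dou : j ≤ dist G o u
        j≤dou = +-cancelʳ-≤ r j (dist G o u) (begin
          j + r                     ≡⟨ sym h≡ ⟩
          dist G o v                ≤⟨ triangle o u v ⟩
          dist G o u + dist G u v   ≤⟨ +-monoʳ-≤ (dist G o u) duv≤r ⟩
          dist G o u + r            ∎)
          where open ≤-Reasoning

    Leads : List (Fin n) → Fin n → ℕ → Standings n → Set
    Leads pool u e (c , waiting) = ∀ s → s ∈ pool → s ∈ waiting ⊎ dist G c u ≤ dist G s u + e

    -- Two consecutive mouse moves u₀ → u₁ → u₂ and the three possible outcomes
    -- of a duel between a leader c (tested at u₀) and a challenger x (tested at
    -- u₁): in each case a bound "c is within e of s" at u₀ survives at u₂ with
    -- the slack increased by 4.
    module TwoMoves {u₀ u₁ u₂ : Fin n}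
                    (move₁ : InClosedNbhd G u₀ u₁) (move₂ : InClosedNbhd G u₁ u₂) where

      drift-away : ∀ c → dist G c u₂ ≤ 2 + dist G c u₀
      drift-away c = ≤-trans (move-away c move₂) (s≤s (move-away c move₁))

      drift-back : ∀ c → dist G c u₀ ≤ 2 + dist G c u₂
      drift-back c = ≤-trans (move-back c move₁) (s≤s (move-back c move₂))

      slack-4 : ∀ a e → 4 + (a + e) ≡ a + (4 + e)
      slack-4 a e = trans (cong (_+ e) (+-comm 4 a)) (+-assoc a 4 e)

      catch-up : ∀ {c s} e → dist G c u₂ ≤ 2 + (dist G s u₀ + e) →
                 dist G c u₂ ≤ dist G s u₂ + (4 + e)
      catch-up {s = s} e h =
        ≤-trans h (≤-trans (s≤s (s≤s (+-monoˡ-≤ e (drift-back s))))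
                           (≤-reflexive (slack-4 (dist G s u₂) e)))

      lead-kept : ∀ {c s} e → dist G c u₀ ≤ dist G s u₀ + e →
                  dist G c u₂ ≤ dist G s u₂ + (4 + e)
      lead-kept {c} e h = catch-up e (≤-trans (drift-away c) (s≤s (s≤s h)))

      lead-won : ∀ {c x s} e → dist G x u₁ ≤ dist G c u₀ → dist G c u₀ ≤ dist G s u₀ + e →
                 dist G x u₂ ≤ dist G s u₂ + (4 + e)
      lead-won {x = x} e won h =
        catch-up e (≤-trans (move-away x move₂) (≤-trans (s≤s (≤-trans won h)) (n≤1+n _)))

      lead-defended : ∀ {c x} e → dist G c u₀ < dist G x u₁ →
                      dist G c u₂ ≤ dist G x u₂ + (4 + e)
      lead-defended {c} {x} e lost = begin
        dist G c u₂             ≤⟨ drift-away c ⟩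
        2 + dist G c u₀         ≤⟨ s≤s lost ⟩
        1 + dist G x u₁         ≤⟨ s≤s (move-back x move₂) ⟩
        2 + dist G x u₂         ≤⟨ s≤s (s≤s (m≤n+m (dist G x u₂) 2)) ⟩
        4 + dist G x u₂         ≤⟨ m≤m+n (4 + dist G x u₂) e ⟩
        4 + (dist G x u₂ + e)   ≡⟨ slack-4 (dist G x u₂) e ⟩
        dist G x u₂ + (4 + e)   ∎
        where open ≤-Reasoning

      duel : ∀ pool e b st →
             (dist G (challenger st) u₁ ≤ dist G (proj₁ st) u₀ ⇔ b ≡ true) →
             Leads pool u₀ e st → Leads pool u₂ (4 + e) (advance b st)
      duel pool e b (c , []) verdict leads s s∈ with leads s s∈
      ... | inj₂ h = inj₂ (lead-kept e h)
      duel pool e true (c , x ∷ waiting) verdict leads s s∈ with leads s s∈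
      ... | inj₁ (Any.here refl) = inj₂ (m≤m+n _ _)
      ... | inj₁ (Any.there w)   = inj₁ w
      ... | inj₂ h               = inj₂ (lead-won e (Equivalence.from verdict refl) h)
      duel pool e false (c , x ∷ waiting) verdict leads s s∈ with leads s s∈
      ... | inj₁ (Any.here refl) =
        inj₂ (lead-defended e (≰⇒> λ won → contradiction (Equivalence.to verdict won) λ ()))
      ... | inj₁ (Any.there w)   = inj₁ w
      ... | inj₂ h               = inj₂ (lead-kept e h)

    -- Every vertex farther than Q from o has, on a shortest path from o, a
    -- vertex of the layer within distance Q.
    layer-dominates : ∀ o Q ρ → ρ < suc Q → Dominates (o ∷ layer o Q ρ) Q
    layer-dominates o Q ρ ρ<q v with dist G o v ≤? Q
    ... | yes near = o , Any.here refl , near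
    ... | no  far
      with j , r , h≡ , r≤Q , j≡ρ ←
             residue-split Q ρ (dist G o v) ρ<q (≤-trans (s≤s⁻¹ ρ<q) (<⇒≤ (≰⇒> far)))
      with u , dou≡j , duv≤r ← geodesic-split o v j r h≡ =
      u , Any.there (∈-filter⁺ (λ x → dist G o x % suc Q ≟ ρ) (∈-allFin u)
                               (trans (cong (_% suc Q) dou≡j) j≡ρ)) ,
      ≤-trans duv≤r r≤Q

module TournamentPlay {n : ℕ} (G : Graph n) (conn : Connected G)
                      (s₀ : Fin n) (cands : List (Fin n)) (m : ℕ → Fin n) where
  open Play G (tournament s₀ cands) m
  open Distance G
  open Metric conn

  standings : ℕ → Standings n
  standings zero    = s₀ , cands
  standings (suc p) = advance (bit (round p)) (standings p)

  answers : ℕ → ℕ → List Bool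
  answers k zero    = []
  answers k (suc L) = bit k ∷ answers (suc k) L

  answers-snoc : ∀ k L → answers k (suc L) ≡ answers k L ++ [ bit (k + L) ]
  answers-snoc k zero    = cong (λ i → bit i ∷ []) (sym (+-identityʳ k))
  answers-snoc k (suc L) =
    cong (bit k ∷_) (trans (answers-snoc (suc k) L)
                           (cong (λ i → answers (suc k) L ++ [ bit i ]) (sym (+-suc k L))))

  bits-answers : ∀ L → bits (suc L) ≡ answers 1 L
  bits-answers zero    = refl
  bits-answers (suc L) = trans (cong (_++ [ bit (suc L) ]) (bits-answers L)) (sym (answers-snoc 1 L))

  cat-tour : ∀ i → cat (suc (suc i)) ≡ tour (s₀ , cands) (answers 1 i)
  cat-tour zero    = refl
  cat-tour (suc i) = cong (tour (s₀ , cands)) (bits-answers (suc i))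

  tour-rounds : ∀ p e → tour (s₀ , cands) (answers 1 (twice p + e)) ≡
                        tour (standings p) (answers (round p) e)
  tour-rounds zero    e = refl
  tour-rounds (suc p) e = trans (cong (λ i → tour (s₀ , cands) (answers 1 i)) two-later)
                                (tour-rounds p (suc (suc e)))
    where
      two-later : twice (suc p) + e ≡ twice p + suc (suc e)
      two-later = sym (trans (+-suc (twice p) (suc e)) (cong suc (+-suc (twice p) e)))

  cat-leader : ∀ p → cat (round p) ≡ proj₁ (standings p)
  cat-leader zero    = refl
  cat-leader (suc p) = trans (cat-tour (round p))
    (trans (cong (λ i → tour (s₀ , cands) (answers 1 i)) (+-comm 1 (twice p))) (tour-rounds p 1))

  cat-challenger : ∀ p → cat (suc (round p)) ≡ challenger (standings p)
  cat-challenger p = trans (cat-tour (twice p))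
    (trans (cong (λ i → tour (s₀ , cands) (answers 1 i)) (sym (+-identityʳ (twice p)))) (tour-rounds p 0))

  standings-waiting : ∀ p → proj₂ (standings p) ≡ drop p cands
  standings-waiting zero    = refl
  standings-waiting (suc p) =
    trans (advance-drop (bit (round p)) (standings p))
          (trans (cong (drop 1) (standings-waiting p))
                 (trans (drop-drop p 1 cands) (cong (λ i → drop i cands) (+-comm p 1))))
    where
      advance-drop : ∀ b st → proj₂ (advance b st) ≡ drop 1 (proj₂ st)
      advance-drop b (c , [])     = refl
      advance-drop b (c , x ∷ xs) = refl

  module Consistent (T : ℕ) (m̃ : ℕ → Fin n)
    (moves : ∀ j → 2 ≤ j → j ≤ T → InClosedNbhd G (m̃ (pred j)) (m̃ j))
    (verdicts : ∀ j → 1 ≤ j → suc j ≤ T →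
                (dist G (cat (suc j)) (m̃ (suc j)) ≤ dist G (cat j) (m̃ j)) ⇔ (bit j ≡ true)) where

    -- Initially only s₀ has played; each round is a duel adding 4 to the slack.
    leads : ∀ p → round p ≤ T → Leads (s₀ ∷ cands) (m̃ (round p)) (4 * p) (standings p)
    leads zero    _ s (Any.here refl) = inj₂ (m≤m+n _ 0)
    leads zero    _ s (Any.there s∈)  = inj₁ s∈
    leads (suc p) end =
      subst (λ e → Leads (s₀ ∷ cands) (m̃ (round (suc p))) e (standings (suc p))) (sym (*-suc 4 p))
            (duel (s₀ ∷ cands) (4 * p) (bit t) (standings p) verdict
                  (leads p (≤-trans (n≤1+n _) (≤-trans (n≤1+n _) end))))
      where
        t : ℕ
        t = round p
        open TwoMoves (moves (suc t) (s≤s (s≤s z≤n)) (≤-trans (n≤1+n _) end))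
                      (moves (suc (suc t)) (s≤s (s≤s z≤n)) end)
        verdict : dist G (challenger (standings p)) (m̃ (suc t)) ≤ dist G (proj₁ (standings p)) (m̃ t) ⇔
                  bit t ≡ true
        verdict = subst₂ (λ x c → (dist G x (m̃ (suc t)) ≤ dist G c (m̃ t)) ⇔ (bit t ≡ true))
                         (cat-challenger p) (cat-leader p) (verdicts t (s≤s z≤n) (≤-trans (n≤1+n _) end))

  -- After all |cands| rounds nobody is waiting: if s₀ ∷ cands Q-dominates G,
  -- every possible mouse position is within Q + 4 |cands| of the leader.
  localises : ∀ Q → Dominates (s₀ ∷ cands) Q →
              RadLe G (InM (round (length cands))) (Q + 4 * length cands)
  localises Q dominates = proj₁ (standings L) , located
    where
      L : ℕ
      L = length cands
      located : ∀ w → InM (round L) w → dist G (proj₁ (standings L)) w ≤ Q + 4 * L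
      located w (m̃ , refl , moves , verdicts)
        with s , s∈ , near ← dominates (m̃ (round L))
        with Consistent.leads (round L) m̃ moves verdicts L ≤-refl s s∈
      ... | inj₁ waiting
            with () ← subst (s ∈_) (trans (standings-waiting L) (drop-all L cands ≤-refl)) waiting
      ... | inj₂ lead = ≤-trans lead (+-monoˡ-≤ (4 * L) near)

theorem1p3 : (n : ℕ) → 1 ≤ n → (G : Graph n) → Connected G →
    Σ (Strategy n) λ S → (m : ℕ → Fin n) → ValidMouse G m →
      Σ ℕ λ i → (1 ≤ i) × (i * i ≤ 2 * n) ×
        Σ ℕ λ r → (r * r ≤ 32 * n) × RadLe G (Play.InM G S m i) r
theorem1p3 n 1≤n G conn
  with k , lower , upper ← odd-square-bracket (2 * n) (≤-trans 1≤n (m≤m+n n (1 * n)))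
  with ρ , ρ<q , sparse ←
         Distance.sparse-layer G (fromℕ< 1≤n) (4 + (k + k)) (suc k) (layer-count n k upper)
  = tournament o cands , λ m _ →
      round L , s≤s z≤n , time-bound L≤k lower ,
      Q + 4 * L , radius-bound {n} L≤k lower ,
      TournamentPlay.localises G conn o cands m Q (Distance.Metric.layer-dominates G conn o Q ρ ρ<q)
  where
    o : Fin n
    o = fromℕ< 1≤n
    Q : ℕ
    Q = 4 + (k + k)
    cands : List (Fin n)
    cands = Distance.layer G o Q ρ
    L : ℕ
    L = length cands
    L≤k : L ≤ k
    L≤k = s≤s⁻¹ sparse
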